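{- Let $a_1$ and $a_2$ be integers with $a_1 \geq 2$ and $a_2 \geq a_1(a_1-1)+1$. If $x_1, x_2$ are integers with $2 \leq x_1 \leq x_2$, $(x_1,x_2) \neq (a_1,a_2)$, and \[ \frac{1}{a_1} + \frac{1}{a_2} \leq \frac{1}{x_1} + \frac{1}{x_2} < \frac{1}{a_1} + \frac{1}{a_2-1}, \] then \[ a_1 + 1 \leq x_1 \leq 2a_1 - 1 \leq x_2 < \frac{a_1 x_1}{x_1 - a_1} \qquad\text{and}\qquad x_2 \leq a_2 - 1. \] -}

module Defs where

open import Data.Nat using (suc)
open import Data.Integer using (ℤ; +_; -[1+_])
import Data.Integer as ℤ
open import Data.Rational using (ℚ; _/_; 0ℚ; _*_)

-- Rational reciprocal of an integer; the value at 0 is a junk value (0),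
-- never used in the statement since all denominators there are ≥ 1.
inv : ℤ → ℚ
inv (+ 0)      = 0ℚ
inv (+ suc n)  = (+ 1) / suc n
inv -[1+ n ]   = ℤ.- (+ 1) / suc n

toℚ : ℤ → ℚ
toℚ z = z / 1

divℚ : ℤ → ℤ → ℚ
divℚ p q = toℚ p * inv q

-- The sum s = 1/x₁ + 1/x₂ lies in the window [1/a₁ + 1/a₂, 1/a₁ + 1/(a₂-1)), and since
-- a₂ - 1 ≥ a₁(a₁-1) the top of the window is at most 1/a₁ + 1/(a₁(a₁-1)) = 1/(a₁-1).
-- Each bound, if violated, pushes s out of the window: x₁ < a₁ or x₂ ≤ 2(a₁-1) give
-- s ≥ 1/(a₁-1); x₁ ≥ 2a₁ gives s ≤ 1/a₁; x₂ ≥ a₂ together with x₁ > a₁ gives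
-- s < 1/a₁ + 1/a₂; and x₁ = a₁ pins x₂ to a₂. Finally s > 1/a₁ rearranges to
-- x₂(x₁ - a₁) < a₁x₁.

module Submission where

open import Defs
open import Data.Nat as ℕ using (suc; z≤n; s≤s)
import Data.Nat.Properties as ℕ
open import Data.Integer as ℤ using (ℤ; +_; 0ℤ; +≤+; +<+; _+_; _-_; _*_; _≤_; _<_)
import Data.Integer.Properties as ℤ
open import Data.Integer.Tactic.RingSolver using (solve-∀)
import Data.Nat.Tactic.RingSolver as ℕ-Solver
open import Data.Rational as ℚ using (0ℚ)
import Data.Rational.Properties as ℚ
open import Data.Rational.Unnormalised as ℚᵘ using (mkℚᵘ; *≡*; *≤*; *<*)
import Data.Rational.Unnormalised.Properties as ℚᵘ
open import Data.Product using (_×_; _,_)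
open import Data.Empty using (⊥-elim)
open import Relation.Binary.Definitions using (tri<; tri≈; tri>)
open import Relation.Binary.PropositionalEquality
open import Relation.Nullary using (¬_)
open import Relation.Nullary.Decidable using (decidable-stable)

i<j⇒i≤j-1 : ∀ {i j} → i < j → i ≤ j - + 1
i<j⇒i≤j-1 {i} {j} i<j = subst (i ≤_) (ℤ.+-comm ℤ.-1ℤ j) (ℤ.i<j⇒i≤pred[j] i<j)

i+1≤j⇒i<j : ∀ {i j} → i + + 1 ≤ j → i < j
i+1≤j⇒i<j {i} {j} i+1≤j = ℤ.suc[i]≤j⇒i<j (subst (_≤ j) (ℤ.+-comm i (+ 1)) i+1≤j)

i<j⇒i+1≤j : ∀ {i j} → i < j → i + + 1 ≤ j
i<j⇒i+1≤j {i} {j} i<j = subst (_≤ j) (ℤ.+-comm (+ 1) i) (ℤ.i<j⇒suc[i]≤j i<j)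

i<j⇒0<j-i : ∀ {i j} → i < j → 0ℤ < j - i
i<j⇒0<j-i {i} {j} i<j = subst (_< j - i) (ℤ.+-inverseʳ i) (ℤ.+-monoˡ-< (ℤ.- i) i<j)

xy<a[x+y]⇒y[x-a]<ax : ∀ {a x y} → x * y < a * (x + y) → y * (x - a) < a * x
xy<a[x+y]⇒y[x-a]<ax {a} {x} {y} lt =
  subst₂ _<_ (lhs a x y) (rhs a x y) (ℤ.+-monoˡ-< (ℤ.- (a * y)) lt)
  where
  lhs : ∀ a x y → x * y - a * y ≡ y * (x - a)
  lhs = solve-∀
  rhs : ∀ a x y → a * (x + y) - a * y ≡ a * x
  rhs = solve-∀

p<p+q : ∀ {p q} → 0ℚ ℚ.< q → p ℚ.< p ℚ.+ q
p<p+q {p} {q} 0<q = subst (ℚ._< p ℚ.+ q) (ℚ.+-identityʳ p) (ℚ.+-monoʳ-< p 0<q)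

toℚᵘ-inv : ∀ k → ℚ.toℚᵘ (inv (+ suc k)) ℚᵘ.≃ mkℚᵘ (+ 1) k
toℚᵘ-inv k = ℚ.toℚᵘ-fromℚᵘ (mkℚᵘ (+ 1) k)

toℚᵘ-inv+inv : ∀ m n → ℚ.toℚᵘ (inv (+ suc m) ℚ.+ inv (+ suc n)) ℚᵘ.≃ mkℚᵘ (+ 1) m ℚᵘ.+ mkℚᵘ (+ 1) n
toℚᵘ-inv+inv m n = ℚᵘ.≃-trans (ℚ.toℚᵘ-homo-+ (inv (+ suc m)) (inv (+ suc n)))
                              (ℚᵘ.+-cong (toℚᵘ-inv m) (toℚᵘ-inv n))

inv-pos : ∀ {n} → 0ℤ < n → 0ℚ ℚ.< inv n
inv-pos {+ suc k} (+<+ (s≤s z≤n)) = ℚ.positive⁻¹ (inv (+ suc k)) {{ℚ.normalize-pos 1 (suc k)}}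

inv-antimono-≤ : ∀ {m n} → 0ℤ < m → m ≤ n → inv n ℚ.≤ inv m
inv-antimono-≤ {+ suc i} {+ suc j} (+<+ (s≤s z≤n)) (+≤+ i≤j) = ℚ.toℚᵘ-cancel-≤
  (ℚᵘ.≤-respˡ-≃ (ℚᵘ.≃-sym (toℚᵘ-inv j)) (ℚᵘ.≤-respʳ-≃ (ℚᵘ.≃-sym (toℚᵘ-inv i))
    (*≤* (+≤+ (ℕ.+-monoˡ-≤ 0 i≤j)))))

inv-antimono-< : ∀ {m n} → 0ℤ < m → m < n → inv n ℚ.< inv m
inv-antimono-< {+ suc i} {+ suc j} (+<+ (s≤s z≤n)) (+<+ i<j) = ℚ.toℚᵘ-cancel-<
  (ℚᵘ.<-respˡ-≃ (ℚᵘ.≃-sym (toℚᵘ-inv j)) (ℚᵘ.<-respʳ-≃ (ℚᵘ.≃-sym (toℚᵘ-inv i))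
    (*<* (+<+ (ℕ.+-monoˡ-< 0 i<j)))))

inv+inv≡inv : ∀ {m n k} → 0ℤ < m → 0ℤ < n → 0ℤ < k →
              (m + n) * k ≡ m * n → inv m ℚ.+ inv n ≡ inv k
inv+inv≡inv {+ suc m} {+ suc n} {+ suc k} (+<+ (s≤s z≤n)) (+<+ (s≤s z≤n)) (+<+ (s≤s z≤n)) eq =
  ℚ.toℚᵘ-injective (ℚᵘ.≃-trans (toℚᵘ-inv+inv m n)
    (ℚᵘ.≃-trans (*≡* (cong +_ cross)) (ℚᵘ.≃-sym (toℚᵘ-inv k))))
  where
  open ≡-Reasoning
  cross : (1 ℕ.* suc n ℕ.+ 1 ℕ.* suc m) ℕ.* suc k ≡ 1 ℕ.* (suc m ℕ.* suc n)
  cross = begin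
    (1 ℕ.* suc n ℕ.+ 1 ℕ.* suc m) ℕ.* suc k
      ≡⟨ cong₂ (λ p q → (p ℕ.+ q) ℕ.* suc k) (ℕ.*-identityˡ (suc n)) (ℕ.*-identityˡ (suc m)) ⟩
    (suc n ℕ.+ suc m) ℕ.* suc k  ≡⟨ cong (ℕ._* suc k) (ℕ.+-comm (suc n) (suc m)) ⟩
    (suc m ℕ.+ suc n) ℕ.* suc k  ≡⟨ ℤ.+-injective eq ⟩
    suc m ℕ.* suc n              ≡⟨ ℕ.*-identityˡ (suc m ℕ.* suc n) ⟨
    1 ℕ.* (suc m ℕ.* suc n)      ∎

inv[2n]+inv[2n]≡inv[n] : ∀ {n} → 0ℤ < n → inv (+ 2 * n) ℚ.+ inv (+ 2 * n) ≡ inv n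
inv[2n]+inv[2n]≡inv[n] {n} 0<n = inv+inv≡inv 0<2n 0<2n 0<n (identity n)
  where
  0<2n : 0ℤ < + 2 * n
  0<2n = ℤ.*-monoˡ-<-pos (+ 2) 0<n
  identity : ∀ n → (+ 2 * n + + 2 * n) * n ≡ + 2 * n * (+ 2 * n)
  identity = solve-∀

inv[a]+inv[c]≤inv[a-1] : ∀ {a c} → + 2 ≤ a → a * (a - + 1) ≤ c → inv a ℚ.+ inv c ℚ.≤ inv (a - + 1)
inv[a]+inv[c]≤inv[a-1] {a} {c} 2≤a a[a-1]≤c = begin
  inv a ℚ.+ inv c                ≤⟨ ℚ.+-monoʳ-≤ (inv a) (inv-antimono-≤ 0<a[a-1] a[a-1]≤c) ⟩
  inv a ℚ.+ inv (a * (a - + 1))  ≡⟨ inv+inv≡inv 0<a 0<a[a-1] 0<a-1 (identity a) ⟩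
  inv (a - + 1)                  ∎
  where
  open ℚ.≤-Reasoning
  0<a-1 : 0ℤ < a - + 1
  0<a-1 = i<j⇒0<j-i (i+1≤j⇒i<j 2≤a)
  0<a : 0ℤ < a
  0<a = ℤ.<-≤-trans (+<+ (s≤s z≤n)) 2≤a
  0<a[a-1] : 0ℤ < a * (a - + 1)
  0<a[a-1] = ℤ.*-monoʳ-<-pos (a - + 1) {{ℤ.positive 0<a-1}} 0<a
  identity : ∀ a → (a + a * (a - + 1)) * (a - + 1) ≡ a * (a * (a - + 1))
  identity = solve-∀

inv<inv+inv⇒xy<a[x+y] : ∀ {a x y} → 0ℤ < a → 0ℤ < x → 0ℤ < y →
                        inv a ℚ.< inv x ℚ.+ inv y → x * y < a * (x + y)
inv<inv+inv⇒xy<a[x+y] {+ suc a} {+ suc x} {+ suc y} (+<+ (s≤s z≤n)) (+<+ (s≤s z≤n)) (+<+ (s≤s z≤n)) lt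
  with ℚᵘ.<-respʳ-≃ (toℚᵘ-inv+inv x y) (ℚᵘ.<-respˡ-≃ (toℚᵘ-inv a) (ℚ.toℚᵘ-mono-< lt))
... | *<* (+<+ cross) = +<+ (subst₂ ℕ._<_ (ℕ.*-identityˡ _) (rearrange x y a) cross)
  where
  rearrange : ∀ x y a → (1 ℕ.* suc y ℕ.+ 1 ℕ.* suc x) ℕ.* suc a ≡ suc a ℕ.* (suc x ℕ.+ suc y)
  rearrange = ℕ-Solver.solve-∀

toℚ<divℚ : ∀ {y m d} → 0ℤ < d → y * d < m → toℚ y ℚ.< divℚ m d
toℚ<divℚ {y} {m} {+ suc d} (+<+ (s≤s z≤n)) yd<m = ℚ.toℚᵘ-cancel-<
  (ℚᵘ.<-respˡ-≃ (ℚᵘ.≃-sym (ℚ.toℚᵘ-fromℚᵘ (mkℚᵘ y 0)))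
  (ℚᵘ.<-respʳ-≃ (ℚᵘ.≃-sym (ℚᵘ.≃-trans (ℚ.toℚᵘ-homo-* (toℚ m) (inv (+ suc d)))
                                        (ℚᵘ.*-cong (ℚ.toℚᵘ-fromℚᵘ (mkℚᵘ m 0)) (toℚᵘ-inv d))))
    (*<* (subst₂ _<_ (cong (λ n → y * + n) (sym (ℕ.*-identityˡ (suc d))))
                     (sym (trans (ℤ.*-identityʳ (m * + 1)) (ℤ.*-identityʳ m))) yd<m))))

module UnitFractionWindow {a₁ a₂ x₁ x₂ : ℤ}
  (2≤a₁ : + 2 ≤ a₁) (a₂-large : a₁ * (a₁ - + 1) + + 1 ≤ a₂)
  (2≤x₁ : + 2 ≤ x₁) (x₁≤x₂ : x₁ ≤ x₂) (x≢a : ¬ ((x₁ , x₂) ≡ (a₁ , a₂)))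
  (lower : inv a₁ ℚ.+ inv a₂ ℚ.≤ inv x₁ ℚ.+ inv x₂)
  (upper : inv x₁ ℚ.+ inv x₂ ℚ.< inv a₁ ℚ.+ inv (a₂ - + 1))
  where

  0<a₁ : 0ℤ < a₁
  0<a₁ = ℤ.<-≤-trans (+<+ (s≤s z≤n)) 2≤a₁

  0<x₁ : 0ℤ < x₁
  0<x₁ = ℤ.<-≤-trans (+<+ (s≤s z≤n)) 2≤x₁

  0<x₂ : 0ℤ < x₂
  0<x₂ = ℤ.<-≤-trans 0<x₁ x₁≤x₂

  a₁[a₁-1]<a₂ : a₁ * (a₁ - + 1) < a₂
  a₁[a₁-1]<a₂ = i+1≤j⇒i<j a₂-large

  0<a₁-1 : 0ℤ < a₁ - + 1
  0<a₁-1 = i<j⇒0<j-i (i+1≤j⇒i<j 2≤a₁)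

  0<a₂ : 0ℤ < a₂
  0<a₂ = ℤ.<-trans (ℤ.*-monoʳ-<-pos (a₁ - + 1) {{ℤ.positive 0<a₁-1}} 0<a₁) a₁[a₁-1]<a₂

  not-below : ¬ (inv a₁ ℚ.+ inv (a₂ - + 1) ℚ.≤ inv x₁ ℚ.+ inv x₂)
  not-below below = ℚ.<-irrefl refl (ℚ.≤-<-trans below upper)

  not-above : ¬ (inv x₁ ℚ.+ inv x₂ ℚ.< inv a₁ ℚ.+ inv a₂)
  not-above above = ℚ.<-irrefl refl (ℚ.<-≤-trans above lower)

  top≤inv[a₁-1] : inv a₁ ℚ.+ inv (a₂ - + 1) ℚ.≤ inv (a₁ - + 1)
  top≤inv[a₁-1] = inv[a]+inv[c]≤inv[a-1] 2≤a₁ (i<j⇒i≤j-1 a₁[a₁-1]<a₂)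

  a₁<x₁ : a₁ < x₁
  a₁<x₁ with ℤ.<-cmp x₁ a₁
  ... | tri> _ _ a₁<x₁ = a₁<x₁
  ... | tri< x₁<a₁ _ _ = ⊥-elim (not-below (begin
    inv a₁ ℚ.+ inv (a₂ - + 1)  ≤⟨ top≤inv[a₁-1] ⟩
    inv (a₁ - + 1)             ≤⟨ inv-antimono-≤ 0<x₁ (i<j⇒i≤j-1 x₁<a₁) ⟩
    inv x₁                     ≤⟨ ℚ.<⇒≤ (p<p+q (inv-pos 0<x₂)) ⟩
    inv x₁ ℚ.+ inv x₂          ∎))
    where open ℚ.≤-Reasoning
  ... | tri≈ _ x₁≡a₁ _ with ℤ.<-cmp x₂ a₂
  ...   | tri< x₂<a₂ _ _ = ⊥-elim (not-below
          (ℚ.+-mono-≤ (ℚ.≤-reflexive (cong inv (sym x₁≡a₁))) (inv-antimono-≤ 0<x₂ (i<j⇒i≤j-1 x₂<a₂))))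
  ...   | tri≈ _ x₂≡a₂ _ = ⊥-elim (x≢a (cong₂ _,_ x₁≡a₁ x₂≡a₂))
  ...   | tri> _ _ a₂<x₂ = ⊥-elim (not-above
          (ℚ.+-mono-≤-< (ℚ.≤-reflexive (cong inv x₁≡a₁)) (inv-antimono-< 0<a₂ a₂<x₂)))

  x₁<2a₁ : x₁ < + 2 * a₁
  x₁<2a₁ = decidable-stable (x₁ ℤ.<? + 2 * a₁) λ x₁≮2a₁ →
    let 2a₁≤x₁ = ℤ.≮⇒≥ x₁≮2a₁
        0<2a₁  = ℤ.*-monoˡ-<-pos (+ 2) 0<a₁
    in not-above (begin-strict
      inv x₁ ℚ.+ inv x₂                    ≤⟨ ℚ.+-mono-≤ (inv-antimono-≤ 0<2a₁ 2a₁≤x₁)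
                                                           (inv-antimono-≤ 0<2a₁ (ℤ.≤-trans 2a₁≤x₁ x₁≤x₂)) ⟩
      inv (+ 2 * a₁) ℚ.+ inv (+ 2 * a₁)    ≡⟨ inv[2n]+inv[2n]≡inv[n] 0<a₁ ⟩
      inv a₁                               <⟨ p<p+q (inv-pos 0<a₂) ⟩
      inv a₁ ℚ.+ inv a₂                    ∎)
    where open ℚ.≤-Reasoning

  2a₁-1≤x₂ : + 2 * a₁ - + 1 ≤ x₂
  2a₁-1≤x₂ = decidable-stable (+ 2 * a₁ - + 1 ℤ.≤? x₂) λ 2a₁-1≰x₂ →
    let x₂≤2[a₁-1] = subst (x₂ ≤_) (2a-1-1≡2[a-1] a₁) (i<j⇒i≤j-1 (ℤ.≰⇒> 2a₁-1≰x₂))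
    in not-below (begin
      inv a₁ ℚ.+ inv (a₂ - + 1)
        ≤⟨ top≤inv[a₁-1] ⟩
      inv (a₁ - + 1)
        ≡⟨ inv[2n]+inv[2n]≡inv[n] 0<a₁-1 ⟨
      inv (+ 2 * (a₁ - + 1)) ℚ.+ inv (+ 2 * (a₁ - + 1))
        ≤⟨ ℚ.+-mono-≤ (inv-antimono-≤ 0<x₁ (ℤ.≤-trans x₁≤x₂ x₂≤2[a₁-1]))
                      (inv-antimono-≤ 0<x₂ x₂≤2[a₁-1]) ⟩
      inv x₁ ℚ.+ inv x₂
        ∎)
    where
    open ℚ.≤-Reasoning
    2a-1-1≡2[a-1] : ∀ a → + 2 * a - + 1 - + 1 ≡ + 2 * (a - + 1)
    2a-1-1≡2[a-1] = solve-∀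

  x₂<a₂ : x₂ < a₂
  x₂<a₂ = decidable-stable (x₂ ℤ.<? a₂) λ x₂≮a₂ →
    not-above (ℚ.+-mono-<-≤ (inv-antimono-< 0<a₁ a₁<x₁) (inv-antimono-≤ 0<a₂ (ℤ.≮⇒≥ x₂≮a₂)))

  x₂<a₁x₁/[x₁-a₁] : toℚ x₂ ℚ.< divℚ (a₁ * x₁) (x₁ - a₁)
  x₂<a₁x₁/[x₁-a₁] = toℚ<divℚ {x₂} {a₁ * x₁} (i<j⇒0<j-i a₁<x₁)
    (xy<a[x+y]⇒y[x-a]<ax {a₁} {x₁} {x₂}
      (inv<inv+inv⇒xy<a[x+y] 0<a₁ 0<x₁ 0<x₂ (ℚ.<-≤-trans (p<p+q (inv-pos 0<a₂)) lower)))

lemma6p1 : (a₁ a₂ x₁ x₂ : ℤ) →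
    + 2 ≤ a₁ →
    a₁ * (a₁ - + 1) + + 1 ≤ a₂ →
    + 2 ≤ x₁ → x₁ ≤ x₂ →
    ¬ ((x₁ , x₂) ≡ (a₁ , a₂)) →
    (inv a₁ ℚ.+ inv a₂) ℚ.≤ (inv x₁ ℚ.+ inv x₂) →
    (inv x₁ ℚ.+ inv x₂) ℚ.< (inv a₁ ℚ.+ inv (a₂ - + 1)) →
    (a₁ + + 1 ≤ x₁) × (x₁ ≤ + 2 * a₁ - + 1) × (+ 2 * a₁ - + 1 ≤ x₂)
      × (toℚ x₂ ℚ.< divℚ (a₁ * x₁) (x₁ - a₁)) × (x₂ ≤ a₂ - + 1)
lemma6p1 a₁ a₂ x₁ x₂ 2≤a₁ a₂-large 2≤x₁ x₁≤x₂ x≢a lower upper =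
  i<j⇒i+1≤j a₁<x₁ , i<j⇒i≤j-1 x₁<2a₁ , 2a₁-1≤x₂ , x₂<a₁x₁/[x₁-a₁] , i<j⇒i≤j-1 x₂<a₂
  where open UnitFractionWindow 2≤a₁ a₂-large 2≤x₁ x₁≤x₂ x≢a lower upper
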